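{- For $d \geq 3$ and $n \geq 2$ it holds \[\mathrm{qc}(n^{\times d}) \geq 2 \left \lfloor \frac{n^{d - 1}}{d - 1} \right \rfloor.\]
   Context: Search game on the grid $S_1\times\cdots\times S_d$ with $S_i=\{0,\ldots,n_i-1\}$: Adversary fixes a target $t$; Algorithm queries a point $q$; if $q\neq t$, Adversary answers for every coordinate $i$ one of $t_i<q_i$ or $t_i>q_i$, at least one of these $d$ inequalities being true, and Algorithm does not learn which one. $\mathrm{qc}(n_1,\ldots,n_d)$ denotes the minimum number of queries that guarantees finding the target (the query complexity); $\mathrm{qc}(n^{\times d})=\mathrm{qc}(n,\ldots,n)$. -}

module Defs where

open import Data.Nat using (ℕ; zero; suc; _<_; _≤_; z≤n; s≤s; NonZero; _∸_)
open import Data.Fin using (Fin; toℕ)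
open import Data.Product using (Σ; _×_; ∃)
open import Data.Sum using (_⊎_)
open import Data.Empty using (⊥)
open import Relation.Nullary using (¬_)
open import Relation.Binary.PropositionalEquality using (_≡_)

Point : {d : ℕ} → (Fin d → ℕ) → Set
Point {d} ns = (i : Fin d) → Fin (ns i)

data Dir : Set where
  lt : Dir
  gt : Dir

Answer : ℕ → Set
Answer d = Fin d → Dir

Holds : Dir → ℕ → ℕ → Set
Holds lt ti qi = ti < qi
Holds gt ti qi = qi < ti

Admissible : {d : ℕ} {ns : Fin d → ℕ} → Point ns → Point ns → Answer d → Set
Admissible t q a = ∃ λ i → Holds (a i) (toℕ (t i)) (toℕ (q i))

-- Candidates : the targets still consistent with everything seen so far.
-- Wins k C : the Algorithm has a (adaptive) strategy that, whatever
-- target in C the Adversary has fixed and whatever admissible answers it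
-- gives, queries the target within k queries.
Wins : {d : ℕ} {ns : Fin d → ℕ} → ℕ → (Point ns → Set) → Set
Wins {ns = ns} zero    C = (t : Point ns) → ¬ C t
Wins {d} {ns} (suc k) C =
  Σ (Point ns) λ q → (a : Answer d) →
    Wins k (λ t → C t × ¬ (t ≡ q) × Admissible t q a)

Solvable : {d : ℕ} → (Fin d → ℕ) → ℕ → Set
Solvable ns k = Wins {ns = ns} k (λ _ → Data.Unit.⊤)
  where import Data.Unit

QcAtLeast : {d : ℕ} → (Fin d → ℕ) → ℕ → Set
QcAtLeast ns m = (k : ℕ) → Solvable ns k → m ≤ k

cube : (d n : ℕ) → Fin d → ℕ
cube d n _ = n

nonZero-pred : {d : ℕ} → 3 ≤ d → NonZero (d ∸ 1)
nonZero-pred {suc (suc (suc _))} _ = _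
nonZero-pred {suc (suc zero)} (s≤s (s≤s ()))
nonZero-pred {suc zero} (s≤s ())

module Submission where

open import Defs
open import Data.Nat using (ℕ; zero; suc; _+_; _*_; _^_; _∸_; _≤_; _<_; z≤n; s≤s; s≤s⁻¹; _≤?_; _<?_; _≟_; NonZero; >-nonZero)
open import Data.Nat.Properties
open import Algebra.Properties.CommutativeMonoid.Sum +-0-commutativeMonoid
  using (sum-syntax; sum-cong-≗; sum-replicate-zero; ∑-distrib-+)
  renaming (sum to ∑)
open import Algebra.Properties.CommutativeSemigroup +-commutativeSemigroup using (interchange)
open import Data.Nat.DivMod using (_/_; _%_; m/n*n≤m; m≡m%n+[m/n]*n; m%n<n)
open import Data.Bool using (true; false; if_then_else_)
open import Data.Fin as Fin using (Fin; toℕ; fromℕ<)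
open import Data.Fin.Properties using (toℕ-fromℕ<; toℕ-injective; toℕ<n) renaming (_≟_ to _≟ᶠ_)
open import Data.Vec as Vec using (Vec; []; _∷_; lookup; tabulate)
open import Data.Vec.Properties using (tabulate∘lookup; lookup∘tabulate; ∷-injective; ≡-dec)
open import Data.List as List using (List; []; _∷_; length; filter; map; _++_; cartesianProductWith; allFin)
open import Data.List.Properties using (filter-all; length-++; length-map; length-tabulate; map-tabulate)
open import Data.List.Relation.Unary.All as All using (All; []; _∷_)
open import Data.List.Relation.Unary.All.Properties using (all-filter) renaming (filter⁺ to All-filter⁺)
open import Data.List.Relation.Unary.AllPairs using ([]; _∷_)
open import Data.List.Relation.Unary.Unique.Propositional using (Unique)
open import Data.List.Relation.Unary.Unique.Propositional.Properties
  using (cartesianProductWith⁺; allFin⁺) renaming (filter⁺ to Unique-filter⁺)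
open import Data.Product using (∃; ∃₂; _×_; _,_; proj₁; proj₂)
open import Data.Sum using (inj₁; inj₂)
open import Data.Empty using (⊥-elim)
open import Data.Unit using (tt)
open import Function using (_∘_)
open import Relation.Nullary using (¬_; Dec; yes; no; ¬?; does)
open import Relation.Nullary.Decidable using (_×-dec_)
open import Relation.Binary.Definitions using (DecidableEquality)
open import Relation.Binary.PropositionalEquality

-- The adversary answers "every coordinate of t exceeds q" when the coordinate sum (height)
-- of q is at most s, and "every coordinate of t is below q" otherwise. Both answers are
-- truthful for every target of height s or s + 1 other than q, so each query rules out at most
-- one point of such a slab, and the query complexity is at least the size of any slab. Every
-- line parallel to the first axis meets the e = d − 1 slabs at heights jn − 1, jn (1 ≤ j ≤ e)
-- twice, except the line through the origin, which meets them once; so together they contain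
-- at least 2n^e − 1 points, and the largest has at least (2n^e − 1)/e of them.

height : ∀ {n k} → Vec (Fin n) k → ℕ
height v = Vec.sum (Vec.map toℕ v)

height≤ : ∀ {n₁ k} (v : Vec (Fin (suc n₁)) k) → height v ≤ k * n₁
height≤ [] = z≤n
height≤ (x ∷ v) = +-mono-≤ (s≤s⁻¹ (toℕ<n x)) (height≤ v)

height≤∧≢⇒∃< : ∀ {n k} (v w : Vec (Fin n) k) → height w ≤ height v → ¬ v ≡ w →
               ∃ λ i → toℕ (lookup w i) < toℕ (lookup v i)
height≤∧≢⇒∃< [] [] _ v≢w = ⊥-elim (v≢w refl)
height≤∧≢⇒∃< (x ∷ v) (y ∷ w) hw≤hv x∷v≢y∷w with toℕ y <? toℕ x
... | yes y<x = Fin.zero , y<x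
... | no y≮x with ≡-dec _≟ᶠ_ v w
...   | yes refl = ⊥-elim (x∷v≢y∷w (cong (_∷ v) (toℕ-injective
                     (≤-antisym (≮⇒≥ y≮x) (+-cancelʳ-≤ (height v) (toℕ y) (toℕ x) hw≤hv)))))
...   | no v≢w =
  let i , wᵢ<vᵢ = height≤∧≢⇒∃< v w hw≤hv′ v≢w in Fin.suc i , wᵢ<vᵢ
  where
  hw≤hv′ : height w ≤ height v
  hw≤hv′ = +-cancelˡ-≤ (toℕ y) (height w) (height v)
             (≤-trans hw≤hv (+-monoˡ-≤ (height v) (≮⇒≥ y≮x)))

InSlab : ℕ → ℕ → Set
InSlab s σ = s ≤ σ × σ ≤ suc s

inSlab? : ∀ s σ → Dec (InSlab s σ)
inSlab? s σ = (s ≤? σ) ×-dec (σ ≤? suc s)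

InSlab-lower : ∀ s → InSlab s s
InSlab-lower s = ≤-refl , n≤1+n s

InSlab-upper : ∀ s → InSlab s (suc s)
InSlab-upper s = n≤1+n s , ≤-refl

module _ {A : Set} (_≟ᴬ_ : DecidableEquality A) where

  length≤1+length-filter-≢ : ∀ w (L : List A) → Unique L →
                             length L ≤ suc (length (filter (λ v → ¬? (v ≟ᴬ w)) L))
  length≤1+length-filter-≢ w [] _ = z≤n
  length≤1+length-filter-≢ w (v ∷ L) (v∉L ∷ unique) with v ≟ᴬ w
  ... | yes refl = s≤s (≤-reflexive (sym (cong length
          (filter-all (λ u → ¬? (u ≟ᴬ v)) (All.map (λ v≢u u≡v → v≢u (sym u≡v)) v∉L)))))
  ... | no _ = s≤s (length≤1+length-filter-≢ w L unique)

module Adversary {n d : ℕ} (s : ℕ) where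

  slabAnswer : Point (cube d n) → Answer d
  slabAnswer q with height (tabulate q) ≤? s
  ... | yes _ = λ _ → gt
  ... | no _  = λ _ → lt

  slabAnswer-admissible : ∀ q (v : Vec (Fin n) d) → InSlab s (height v) → ¬ v ≡ tabulate q →
                          Admissible (lookup v) q (slabAnswer q)
  slabAnswer-admissible q v (s≤hv , hv≤1+s) v≢q with height (tabulate q) ≤? s
  ... | yes hq≤s =
    let i , qᵢ<vᵢ = height≤∧≢⇒∃< v (tabulate q) (≤-trans hq≤s s≤hv) v≢q
    in i , subst (λ z → toℕ z < toℕ (lookup v i)) (lookup∘tabulate q i) qᵢ<vᵢ
  ... | no hq≰s =
    let i , vᵢ<qᵢ = height≤∧≢⇒∃< (tabulate q) v (≤-trans hv≤1+s (≰⇒> hq≰s)) (v≢q ∘ sym)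
    in i , subst (λ z → toℕ (lookup v i) < toℕ z) (lookup∘tabulate q i) vᵢ<qᵢ

  wins⇒length≤ : ∀ k {C : Point (cube d n) → Set} (L : List (Vec (Fin n) d)) → Unique L →
                 All (λ v → C (lookup v) × InSlab s (height v)) L → Wins k C → length L ≤ k
  wins⇒length≤ zero    []      _ _               _ = z≤n
  wins⇒length≤ zero    (v ∷ _) _ ((c , _) ∷ _) none = ⊥-elim (none (lookup v) c)
  wins⇒length≤ (suc k) {C} L unique candidates (q , continue) =
    ≤-trans (length≤1+length-filter-≢ _≟ᵛ_ w L unique)
      (s≤s (wins⇒length≤ k rest (Unique-filter⁺ _ unique)
        (All.map stillCandidate (All.zip (All-filter⁺ _ candidates , all-filter _ L)))
        (continue (slabAnswer q))))
    where
    _≟ᵛ_ : DecidableEquality (Vec (Fin n) d)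
    _≟ᵛ_ = ≡-dec _≟ᶠ_
    w : Vec (Fin n) d
    w = tabulate q
    rest : List (Vec (Fin n) d)
    rest = filter (λ v → ¬? (v ≟ᵛ w)) L
    stillCandidate : ∀ {v} → (C (lookup v) × InSlab s (height v)) × ¬ v ≡ w →
                     (C (lookup v) × ¬ lookup v ≡ q × Admissible (lookup v) q (slabAnswer q))
                       × InSlab s (height v)
    stillCandidate {v} ((c , inSlab) , v≢w) =
      (c , (λ v≡q → v≢w (trans (sym (tabulate∘lookup v)) (cong tabulate v≡q)))
         , slabAnswer-admissible q v inSlab v≢w) , inSlab

indicator : ∀ {P : Set} → Dec P → ℕ
indicator P? = if does P? then 1 else 0

1≤indicator : ∀ {P : Set} (P? : Dec P) → P → 1 ≤ indicator P?
1≤indicator (yes _) _ = ≤-refl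
1≤indicator (no ¬p) p = ⊥-elim (¬p p)

term≤∑ : ∀ {m} (t : Fin m → ℕ) i → t i ≤ ∑ t
term≤∑ t Fin.zero    = m≤m+n _ _
term≤∑ t (Fin.suc i) = ≤-trans (term≤∑ (t ∘ Fin.suc) i) (m≤n+m _ _)

two-terms≤∑ : ∀ {m} (t : Fin m → ℕ) {i j} → i Fin.< j → t i + t j ≤ ∑ t
two-terms≤∑ t {Fin.zero}  {Fin.suc j} _       = +-monoʳ-≤ (t Fin.zero) (term≤∑ (t ∘ Fin.suc) j)
two-terms≤∑ t {Fin.suc i} {Fin.suc j} (s≤s i<j) = ≤-trans (two-terms≤∑ (t ∘ Fin.suc) i<j) (m≤n+m _ _)

∑≤*  : ∀ {m} (t : Fin m → ℕ) {k} → (∀ i → t i ≤ k) → ∑ t ≤ m * k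
∑≤* {zero}  t _    = z≤n
∑≤* {suc m} t t≤k = +-mono-≤ (t≤k Fin.zero) (∑≤* (t ∘ Fin.suc) (t≤k ∘ Fin.suc))

module _ {A : Set} where

  sumL : (A → ℕ) → List A → ℕ
  sumL f []       = 0
  sumL f (x ∷ xs) = f x + sumL f xs

  sumL-++ : ∀ f xs ys → sumL f (xs ++ ys) ≡ sumL f xs + sumL f ys
  sumL-++ f []       ys = refl
  sumL-++ f (x ∷ xs) ys = trans (cong (f x +_) (sumL-++ f xs ys)) (sym (+-assoc (f x) _ _))

  sumL-+ : ∀ f g xs → sumL (λ x → f x + g x) xs ≡ sumL f xs + sumL g xs
  sumL-+ f g []       = refl
  sumL-+ f g (x ∷ xs) = trans (cong (f x + g x +_) (sumL-+ f g xs))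
                              (interchange (f x) (g x) (sumL f xs) (sumL g xs))

  sumL-cong : ∀ {f g} → (∀ x → f x ≡ g x) → ∀ xs → sumL f xs ≡ sumL g xs
  sumL-cong f≡g []       = refl
  sumL-cong f≡g (x ∷ xs) = cong₂ _+_ (f≡g x) (sumL-cong f≡g xs)

  sumL-mono : ∀ {f g} → (∀ x → f x ≤ g x) → ∀ xs → sumL f xs ≤ sumL g xs
  sumL-mono f≤g []       = z≤n
  sumL-mono f≤g (x ∷ xs) = +-mono-≤ (f≤g x) (sumL-mono f≤g xs)

  sumL-const : ∀ c xs → sumL (λ _ → c) xs ≡ length xs * c
  sumL-const c []       = refl
  sumL-const c (x ∷ xs) = cong (c +_) (sumL-const c xs)

  sumL-∑ : ∀ {m} (f : Fin m → A → ℕ) xs → sumL (λ x → ∑[ j < m ] f j x) xs ≡ ∑[ j < m ] sumL (f j) xs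
  sumL-∑ {m} f []       = sym (sum-replicate-zero m)
  sumL-∑ f (x ∷ xs) = trans (cong (∑ (λ j → f j x) +_) (sumL-∑ f xs))
                            (sym (∑-distrib-+ (λ j → f j x) (λ j → sumL (f j) xs)))

  length-filter≡sumL : ∀ {P : A → Set} (P? : ∀ x → Dec (P x)) xs →
                       length (filter P? xs) ≡ sumL (indicator ∘ P?) xs
  length-filter≡sumL P? []       = refl
  length-filter≡sumL P? (x ∷ xs) with does (P? x)
  ... | true  = cong suc (length-filter≡sumL P? xs)
  ... | false = length-filter≡sumL P? xs

  sumL-tabulate : ∀ {m} (f : A → ℕ) (g : Fin m → A) → sumL f (List.tabulate g) ≡ ∑[ i < m ] f (g i)
  sumL-tabulate {zero}  f g = refl
  sumL-tabulate {suc m} f g = cong (f (g Fin.zero) +_) (sumL-tabulate f (g ∘ Fin.suc))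

length-cartesianProductWith : ∀ {A B C : Set} (f : A → B → C) xs ys →
                              length (cartesianProductWith f xs ys) ≡ length xs * length ys
length-cartesianProductWith f []       ys = refl
length-cartesianProductWith f (x ∷ xs) ys = begin
  length (map (f x) ys ++ cartesianProductWith f xs ys)     ≡⟨ length-++ (map (f x) ys) ⟩
  length (map (f x) ys) + length (cartesianProductWith f xs ys)
    ≡⟨ cong₂ _+_ (length-map (f x) ys) (length-cartesianProductWith f xs ys) ⟩
  length ys + length xs * length ys                         ∎
  where open ≡-Reasoning

module Enumeration (n : ℕ) where

  vectors : ∀ k → List (Vec (Fin n) k)
  vectors zero    = [] ∷ []
  vectors (suc k) = cartesianProductWith (λ u x → x ∷ u) (vectors k) (allFin n)

  vectors-unique : ∀ k → Unique (vectors k)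
  vectors-unique zero    = [] ∷ []
  vectors-unique (suc k) = cartesianProductWith⁺ (λ u x → x ∷ u)
    (λ x∷u≡y∷v → let x≡y , u≡v = ∷-injective x∷u≡y∷v in u≡v , x≡y)
    (vectors-unique k) (allFin⁺ n)

  length-vectors : ∀ k → length (vectors k) ≡ n ^ k
  length-vectors zero    = refl
  length-vectors (suc k) = begin
    length (vectors (suc k))          ≡⟨ length-cartesianProductWith _ (vectors k) (allFin n) ⟩
    length (vectors k) * length (allFin n) ≡⟨ cong₂ _*_ (length-vectors k) (length-tabulate (λ i → i)) ⟩
    n ^ k * n                         ≡⟨ *-comm (n ^ k) n ⟩
    n ^ suc k                         ∎
    where open ≡-Reasoning

  sumL-vectors : ∀ k (f : Vec (Fin n) (suc k) → ℕ) →
                 sumL f (vectors (suc k)) ≡ sumL (λ u → ∑[ x < n ] f (x ∷ u)) (vectors k)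
  sumL-vectors k f = go (vectors k)
    where
    go : ∀ us → sumL f (cartesianProductWith (λ u x → x ∷ u) us (allFin n)) ≡
                sumL (λ u → ∑[ x < n ] f (x ∷ u)) us
    go []       = refl
    go (u ∷ us) = begin
      sumL f (map (_∷ u) (allFin n) ++ cartesianProductWith (λ u x → x ∷ u) us (allFin n))
        ≡⟨ sumL-++ f (map (_∷ u) (allFin n)) _ ⟩
      sumL f (map (_∷ u) (allFin n)) + sumL f (cartesianProductWith (λ u x → x ∷ u) us (allFin n))
        ≡⟨ cong₂ _+_ (trans (cong (sumL f) (map-tabulate (λ i → i) (_∷ u))) (sumL-tabulate f (_∷ u))) (go us) ⟩
      ∑[ x < n ] f (x ∷ u) + sumL (λ u → ∑[ x < n ] f (x ∷ u)) us ∎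
      where open ≡-Reasoning

-- For n = m + 2, slab j < e consists of the points at the two levels top j = (j + 1) n − 1
-- and (j + 1) n. Over a point u of the last e coordinates, column (height u) counts the
-- memberships of the points (x , u), x < n, in these slabs.
module Slabs (m e : ℕ) where

  n₁ n : ℕ
  n₁ = suc m
  n  = suc n₁

  open Enumeration n

  top : ℕ → ℕ
  top j = j * n + n₁

  multiplicity : ℕ → ℕ
  multiplicity σ = ∑[ j < e ] indicator (inSlab? (top (toℕ j)) σ)

  column : ℕ → ℕ
  column σ = ∑[ x < n ] multiplicity (toℕ x + σ)

  Hit : ℕ → ℕ → Set
  Hit σ x = x < n × ∃ λ j → j < e × InSlab (top j) (x + σ)

  1≤multiplicity : ∀ {j σ} → j < e → InSlab (top j) σ → 1 ≤ multiplicity σ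
  1≤multiplicity {j} {σ} j<e inSlab = begin
    1                                               ≤⟨ 1≤indicator (inSlab? (top j) σ) inSlab ⟩
    indicator (inSlab? (top j) σ)                   ≡⟨ cong (λ i → indicator (inSlab? (top i) σ)) (toℕ-fromℕ< j<e) ⟨
    indicator (inSlab? (top (toℕ (fromℕ< j<e))) σ) ≤⟨ term≤∑ _ (fromℕ< j<e) ⟩
    multiplicity σ                                  ∎
    where open ≤-Reasoning

  hit⇒1≤term : ∀ {σ x} (hit : Hit σ x) → 1 ≤ multiplicity (toℕ (fromℕ< (proj₁ hit)) + σ)
  hit⇒1≤term {σ} (x<n , j , j<e , inSlab) =
    1≤multiplicity j<e (subst (λ y → InSlab (top j) (y + σ)) (sym (toℕ-fromℕ< x<n)) inSlab)

  1≤column : ∀ {σ x} → Hit σ x → 1 ≤ column σ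
  1≤column {σ} hit = ≤-trans (hit⇒1≤term hit) (term≤∑ (λ x → multiplicity (toℕ x + σ)) (fromℕ< (proj₁ hit)))

  2≤column : ∀ {σ x y} → x < y → Hit σ x → Hit σ y → 2 ≤ column σ
  2≤column {σ} {x} {y} x<y hitx@(x<n , _) hity@(y<n , _) =
    ≤-trans (+-mono-≤ (hit⇒1≤term hitx) (hit⇒1≤term hity))
      (two-terms≤∑ (λ x → multiplicity (toℕ x + σ)) (subst₂ _<_ (sym (toℕ-fromℕ< x<n)) (sym (toℕ-fromℕ< y<n)) x<y))

  -- Division with remainder: σ = j n + r with r < n, and the column above σ reaches
  -- the top j n + n₁ at offset n₁ − r.
  reach-top : ∀ σ → ∃₂ λ j x → x < n × x + σ ≡ top j × j * n ≤ σ
  reach-top σ = σ / n , n₁ ∸ r , s≤s (m∸n≤m n₁ r) , x+σ≡top , m/n*n≤m σ n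
    where
    r : ℕ
    r = σ % n
    open ≡-Reasoning
    x+σ≡top : n₁ ∸ r + σ ≡ top (σ / n)
    x+σ≡top = begin
      n₁ ∸ r + σ                ≡⟨ cong (n₁ ∸ r +_) (m≡m%n+[m/n]*n σ n) ⟩
      n₁ ∸ r + (r + σ / n * n)  ≡⟨ +-assoc (n₁ ∸ r) r _ ⟨
      n₁ ∸ r + r + σ / n * n    ≡⟨ cong (_+ σ / n * n) (m∸n+n≡m (s≤s⁻¹ (m%n<n σ n))) ⟩
      n₁ + σ / n * n            ≡⟨ +-comm n₁ _ ⟩
      top (σ / n)               ∎

  index<e : ∀ j {σ} → 1 ≤ e → j * n ≤ σ → σ ≤ e * n₁ → j < e
  index<e j {σ} 1≤e jn≤σ σ≤en₁ = *-cancelʳ-< n j e (begin-strict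
    j * n   ≤⟨ jn≤σ ⟩
    σ       ≤⟨ σ≤en₁ ⟩
    e * n₁  <⟨ *-monoʳ-< e ≤-refl ⟩
    e * n   ∎)
    where
    open ≤-Reasoning
    instance _ : NonZero e
             _ = >-nonZero 1≤e

  hit-lower : ∀ {σ x} j → j < e → x < n → x + σ ≡ top j → Hit σ x
  hit-lower j j<e x<n x+σ≡top = x<n , j , j<e , subst (InSlab (top j)) (sym x+σ≡top) (InSlab-lower (top j))

  hit-upper : ∀ {σ x} j → j < e → x < n → x + σ ≡ suc (top j) → Hit σ x
  hit-upper j j<e x<n x+σ≡top+1 = x<n , j , j<e , subst (InSlab (top j)) (sym x+σ≡top+1) (InSlab-upper (top j))

  hit-at-top : ∀ {σ} → 1 ≤ e → σ ≤ e * n₁ → ∃ (Hit σ)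
  hit-at-top {σ} 1≤e σ≤en₁ =
    let j , x , x<n , x+σ≡top , jn≤σ = reach-top σ
    in x , hit-lower j (index<e j 1≤e jn≤σ σ≤en₁) x<n x+σ≡top

  hit-at-multiple : ∀ {σ} i → suc σ ≡ i * n → i < e → Hit (suc σ) 0
  hit-at-multiple (suc i) σ≡in i<e =
    hit-upper i (<-trans (n<1+n i) i<e) (s≤s z≤n) (trans σ≡in (cong suc (+-comm n₁ (i * n))))

  -- Below the top of block j the column also meets the upper level of block j; if the top
  -- is the last cell of the column, then σ is a multiple of n, the upper level of block j − 1.
  two-hits : ∀ {σ} → 1 ≤ e → suc σ ≤ e * n₁ → ∃₂ λ x y → x < y × Hit (suc σ) x × Hit (suc σ) y
  two-hits {σ} 1≤e σ≤en₁ with reach-top (suc σ)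
  ... | j , x , x<n , x+σ≡top , jn≤σ with index<e j 1≤e jn≤σ σ≤en₁ | m≤n⇒m<n∨m≡n (s≤s⁻¹ x<n)
  ...   | j<e | inj₁ x<n₁ =
    x , suc x , ≤-refl , hit-lower j j<e x<n x+σ≡top , hit-upper j j<e (s≤s x<n₁) (cong suc x+σ≡top)
  ...   | j<e | inj₂ refl =
    0 , n₁ , s≤s z≤n , hit-at-multiple j σ≡jn j<e , hit-lower j j<e x<n x+σ≡top
    where
    σ≡jn : suc σ ≡ j * n
    σ≡jn = +-cancelˡ-≡ n₁ (suc σ) (j * n) (trans x+σ≡top (+-comm (j * n) n₁))

  column-bound : 1 ≤ e → ∀ σ → σ ≤ e * n₁ → 2 ≤ column σ + indicator (σ ≟ 0)
  column-bound 1≤e zero    σ≤en₁ = +-monoˡ-≤ 1 (1≤column (proj₂ (hit-at-top 1≤e σ≤en₁)))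
  column-bound 1≤e (suc σ) σ≤en₁ =
    let _ , _ , x<y , hitx , hity = two-hits 1≤e σ≤en₁
    in ≤-trans (2≤column x<y hitx hity) (m≤m+n _ 0)

  layer : ℕ → List (Vec (Fin n) (suc e))
  layer j = filter (λ v → inSlab? (top j) (height v)) (vectors (suc e))

  ∑-length-layer : ∑[ j < e ] length (layer (toℕ j)) ≡ sumL (column ∘ height) (vectors e)
  ∑-length-layer = begin
    ∑[ j < e ] length (layer (toℕ j))
      ≡⟨ sum-cong-≗ {e} (λ j → length-filter≡sumL (λ v → inSlab? (top (toℕ j)) (height v)) (vectors (suc e))) ⟩
    ∑[ j < e ] sumL (λ v → indicator (inSlab? (top (toℕ j)) (height v))) (vectors (suc e))
      ≡⟨ sumL-∑ {m = e} (λ j v → indicator (inSlab? (top (toℕ j)) (height v))) (vectors (suc e)) ⟨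
    sumL (multiplicity ∘ height) (vectors (suc e))
      ≡⟨ sumL-vectors e (multiplicity ∘ height) ⟩
    sumL (column ∘ height) (vectors e)
      ∎
    where open ≡-Reasoning

  count-height≡0 : ∀ k → sumL (λ u → indicator (height u ≟ 0)) (vectors k) ≡ 1
  count-height≡0 zero    = refl
  count-height≡0 (suc k) = begin
    sumL (λ u → indicator (height u ≟ 0)) (vectors (suc k))
      ≡⟨ sumL-vectors k (λ u → indicator (height u ≟ 0)) ⟩
    sumL (λ u → indicator (height u ≟ 0) + ∑[ x < n₁ ] 0) (vectors k)
      ≡⟨ sumL-cong (λ u → cong (indicator (height u ≟ 0) +_) (sum-replicate-zero n₁)) (vectors k) ⟩
    sumL (λ u → indicator (height u ≟ 0) + 0) (vectors k)
      ≡⟨ sumL-cong (λ u → +-identityʳ _) (vectors k) ⟩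
    sumL (λ u → indicator (height u ≟ 0)) (vectors k)
      ≡⟨ count-height≡0 k ⟩
    1 ∎
    where open ≡-Reasoning

  layers-cover : 1 ≤ e → 2 * n ^ e ≤ ∑[ j < e ] length (layer (toℕ j)) + 1
  layers-cover 1≤e = begin
    2 * n ^ e                       ≡⟨ *-comm 2 (n ^ e) ⟩
    n ^ e * 2                       ≡⟨ cong (_* 2) (length-vectors e) ⟨
    length (vectors e) * 2          ≡⟨ sumL-const 2 (vectors e) ⟨
    sumL (λ _ → 2) (vectors e)
      ≤⟨ sumL-mono (λ u → column-bound 1≤e (height u) (height≤ u)) (vectors e) ⟩
    sumL (λ u → column (height u) + indicator (height u ≟ 0)) (vectors e)
      ≡⟨ sumL-+ (column ∘ height) (λ u → indicator (height u ≟ 0)) (vectors e) ⟩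
    sumL (column ∘ height) (vectors e) + sumL (λ u → indicator (height u ≟ 0)) (vectors e)
      ≡⟨ cong₂ _+_ (sym ∑-length-layer) (count-height≡0 e) ⟩
    ∑[ j < e ] length (layer (toℕ j)) + 1 ∎
    where open ≤-Reasoning

2N≤ek+1⇒2[N/e]≤k : ∀ e N k .{{_ : NonZero e}} → 2 ≤ e → 2 * N ≤ e * k + 1 → 2 * (N / e) ≤ k
2N≤ek+1⇒2[N/e]≤k e N k 2≤e 2N≤ek+1 = s≤s⁻¹ (*-cancelˡ-< e (2 * (N / e)) (suc k) (begin-strict
  e * (2 * (N / e))  ≡⟨ *-comm e _ ⟩
  2 * (N / e) * e    ≡⟨ *-assoc 2 (N / e) e ⟩
  2 * (N / e * e)    ≤⟨ *-monoʳ-≤ 2 (m/n*n≤m N e) ⟩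
  2 * N              ≤⟨ 2N≤ek+1 ⟩
  e * k + 1          <⟨ +-monoʳ-< (e * k) 2≤e ⟩
  e * k + e          ≡⟨ +-comm (e * k) e ⟩
  e + e * k          ≡⟨ *-suc e k ⟨
  e * suc k          ∎))
  where open ≤-Reasoning

theorem3 : (d n : ℕ) → (h : 3 ≤ d) → 2 ≤ n →
    QcAtLeast (cube d n) (2 * _/_ (n ^ (d ∸ 1)) (d ∸ 1) {{nonZero-pred h}})
theorem3 (suc e@(suc (suc _))) n@(suc (suc m)) (s≤s (s≤s (s≤s z≤n))) (s≤s (s≤s z≤n)) k solvable =
  2N≤ek+1⇒2[N/e]≤k e (n ^ e) k (s≤s (s≤s z≤n)) (begin
    2 * n ^ e                              ≤⟨ layers-cover (s≤s z≤n) ⟩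
    ∑[ j < e ] length (layer (toℕ j)) + 1  ≤⟨ +-monoˡ-≤ 1 (∑≤* {e} (λ j → length (layer (toℕ j))) layer-small) ⟩
    e * k + 1                              ∎)
  where
  open Slabs m e hiding (n)
  open Enumeration n
  open ≤-Reasoning
  layer-small : ∀ j → length (layer (toℕ j)) ≤ k
  layer-small j = Adversary.wins⇒length≤ (top (toℕ j)) k (layer (toℕ j))
    (Unique-filter⁺ _ (vectors-unique (suc e)))
    (All.map (tt ,_) (all-filter (λ v → inSlab? (top (toℕ j)) (height v)) (vectors (suc e)))) solvable
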